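{- Let $k\ge1$, $q=2^k$, and $a\in F_q$ with $\mathrm{tr}(a)=1$. Then the map $z\mapsto a/(z+1)$ (with $\infty\mapsto 0$ and $1\mapsto\infty$) is an automorphism of $G_k(a)$. Moreover, if $k$ is even, the map $z\mapsto z+1$ (with $\infty\mapsto\infty$) is also an automorphism of $G_k(a)$.
   Context: $F_q$ denotes the finite field with $q=2^k$ elements, and $\mathrm{tr}:F_q\to F_2$ is $\mathrm{tr}(x)=x+x^2+x^4+\cdots+x^{q/2}$. The vertex set is $V=F_q\cup\{\infty\}$. For $a\in F_q$ with $\mathrm{tr}(a)=1$ and distinct $x,y\in V$, define $R_a(x,y)=\frac{xy+x+a}{x+y}$ when $x,y\in F_q$, with $R_a(\infty,y)=y+1$ and $R_a(x,\infty)=x$ for $x,y\in F_q$. For $k$ even, $G_k(a)$ is the graph on $V$ where distinct $x,y$ are adjacent iff $\mathrm{tr}(R_a(x,y))=0$; for $k$ odd, $G_k(a)$ is the tournament on $V$ with an arc $x\to y$ iff $\mathrm{tr}(R_a(x,y))=0$. -}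

module Defs where

open import Level using (0ℓ)
open import Data.Nat using (ℕ; zero; suc; _^_)
open import Data.Fin using (Fin)
open import Data.Fin.Properties using () renaming (_≟_ to _≟ᶠ_)
open import Data.Maybe using (Maybe; just; nothing)
open import Data.Product using (_×_; _,_)
open import Relation.Nullary using (¬_; yes; no; Dec)
open import Relation.Binary.PropositionalEquality using (_≡_; _≢_; cong)
open import Relation.Binary.Definitions using (DecidableEquality)
open import Algebra.Core using (Op₁; Op₂)
open import Algebra.Structures using (IsCommutativeRing)
open import Function.Bundles using (_↔_; Inverse; _⇔_)
open import Function.Definitions using (Bijective)

-- A field (with propositional equality).  The inverse is total; its value
-- at 0# is unspecified and never used below.
record Field : Set₁ where
  infixl 6 _+_
  infixl 7 _*_
  field
    Carrier : Set
    _+_ _*_ : Op₂ Carrier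
    -_      : Op₁ Carrier
    0# 1#   : Carrier
    isCommutativeRing : IsCommutativeRing _≡_ _+_ _*_ -_ 0# 1#
    _⁻¹     : Op₁ Carrier
    0≢1     : 0# ≢ 1#
    ⁻¹-inverse : ∀ x → x ≢ 0# → x * (x ⁻¹) ≡ 1#

module FieldOps (F : Field) where
  open Field F

  pow : Carrier → ℕ → Carrier
  pow x zero    = 1#
  pow x (suc n) = x * pow x n

  tr : ℕ → Carrier → Carrier
  tr zero    x = 0#
  tr (suc i) x = tr i x + pow x (2 ^ i)

  -- vertex set  F_q ∪ {∞},  with  nothing = ∞
  V : Set
  V = Maybe Carrier

  -- R_a(x,y); the value at (∞,∞) is irrelevant (only distinct pairs are used)
  R : Carrier → V → V → Carrier
  R a (just x) (just y) = (x * y + x + a) * ((x + y) ⁻¹)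
  R a nothing  (just y) = y + 1#
  R a (just x) nothing  = x
  R a nothing  nothing  = 0#

  -- adjacency of G_k(a) (k even: edge relation; k odd: arc relation x → y)
  Adj : ℕ → Carrier → V → V → Set
  Adj k a x y = (x ≢ y) × (tr k (R a x y) ≡ 0#)

  IsAutomorphism : ℕ → Carrier → (V → V) → Set
  IsAutomorphism k a σ =
    Bijective _≡_ _≡_ σ × (∀ x y → Adj k a x y ⇔ Adj k a (σ x) (σ y))

-- The statement fixes |F| = 2^k via an explicit bijection with Fin (2^k).
module FiniteFieldOps (F : Field) (k : ℕ) (e : Field.Carrier F ↔ Fin (2 ^ k)) where
  open Field F
  open FieldOps F public
  open Inverse e using (to; from; inverseʳ)

  _≟F_ : DecidableEquality Carrier
  x ≟F y with to x ≟ᶠ to y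
  ... | yes p = yes (trans (sym (inverseʳ refl)) (trans (cong from p) (inverseʳ refl)))
    where open import Relation.Binary.PropositionalEquality using (trans; sym; refl)
  ... | no ¬p = no (λ q → ¬p (cong to q))

  σ₁ : Carrier → V → V
  σ₁ a nothing  = just 0#
  σ₁ a (just z) with z ≟F 1#
  ... | yes _ = nothing
  ... | no  _ = just (a * ((z + 1#) ⁻¹))

  σ₂ : V → V
  σ₂ nothing  = nothing
  σ₂ (just z) = just (z + 1#)

-- Since |F| = 2 ^ k is even, F has characteristic two.  Both the translation
-- σ₂ : z ↦ z + 1 and the map ρ : z ↦ a / z (swapping 0 and ∞, for a ≠ 0) shift
-- R_a by one: R_a(σx, σy) = R_a(x, y) + 1 for distinct x, y.  Now σ₁ = ρ ∘ σ₂, so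
-- σ₁ preserves R_a itself and is a bijection with inverse σ₂ ∘ ρ.  When k is
-- even, tr 1 = k · 1 = 0, so by additivity of the trace σ₂ preserves tr ∘ R_a.

module Submission where

open import Defs
open import Data.Nat using (ℕ; zero; suc; _≤_; s≤s; _^_)
open import Data.Nat.Properties using (≤-refl; ≤-trans; n≤1+n)
import Data.Nat as ℕ
import Data.Nat.Properties as ℕₚ
open import Data.Nat.Divisibility
  using (_∣_; divides; _∣0; ∣-refl; ∣m∣n⇒∣m+n; ∣m+n∣m⇒∣n; ∣1⇒≡1; m∣m*n)
open import Data.Fin using (Fin)
open import Data.Bool using (Bool; true; false; _xor_; _∧_; if_then_else_)
open import Data.Maybe using (Maybe; just; nothing)
open import Data.List using (List; []; _∷_; length; filter; tabulate)
open import Data.List.Properties using (filter-accept; filter-reject; filter-all; length-tabulate)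
open import Data.List.Membership.Propositional using (_∈_)
open import Data.List.Membership.Propositional.Properties using (∈-filter⁺; ∈-filter⁻; ∈-tabulate⁺)
open import Data.List.Relation.Unary.Any using (here; there)
open import Data.List.Relation.Unary.All.Properties using (All¬⇒¬Any)
open import Data.List.Relation.Unary.AllPairs using (_∷_)
open import Data.List.Relation.Unary.Unique.Propositional using (Unique)
import Data.List.Relation.Unary.Unique.Propositional.Properties as Unique
open import Data.Product using (_×_; _,_; proj₁; proj₂)
open import Function using (_∘_; Injective; case_of_; Bijective; _⇔_; mk⇔; _↔_; Inverse; mk↔ₛ′)
open import Function.Properties.Inverse using (Inverse⇒Bijection)
open import Function.Bundles using (Bijection)
open import Level using (0ℓ)
open import Relation.Nullary using (¬_; yes; no; contradiction)
open import Relation.Nullary.Decidable using (¬?)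
open import Relation.Binary.Definitions using (DecidableEquality)
open import Relation.Binary.PropositionalEquality
open import Algebra.Bundles using (CommutativeRing; RawRing)
open import Algebra.Solver.Ring.AlmostCommutativeRing
  using (fromCommutativeRing; _-Raw-AlmostCommutative⟶_)
import Algebra.Properties.CommutativeSemigroup as CommutativeSemigroupProperties
import Algebra.Properties.Group as GroupProperties
import Algebra.Solver.Ring as RingSolver

involutive⇒injective : ∀ {a} {A : Set a} (f : A → A) → (∀ x → f (f x) ≡ x) → Injective _≡_ _≡_ f
involutive⇒injective f f∘f≗id {x} {y} fx≡fy =
  trans (sym (f∘f≗id x)) (trans (cong f fx≡fy) (f∘f≗id y))

module InvolutionParity {a} {A : Set a} (_≟_ : DecidableEquality A)
  (f : A → A) (f-involutive : ∀ x → f (f x) ≡ x) where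

  _without_ : List A → A → List A
  xs without y = filter (λ w → ¬? (y ≟ w)) xs

  ∈-without⁺ : ∀ {w y xs} → w ∈ xs → y ≢ w → w ∈ xs without y
  ∈-without⁺ = ∈-filter⁺ (λ w → ¬? (_ ≟ w))

  ∈-without⁻ : ∀ {w y} xs → w ∈ xs without y → w ∈ xs × y ≢ w
  ∈-without⁻ xs = ∈-filter⁻ (λ w → ¬? (_ ≟ w)) {xs = xs}

  length-without : ∀ {y xs} → Unique xs → y ∈ xs → length xs ≡ suc (length (xs without y))
  length-without {y} {x ∷ xs} (x∉xs ∷ _) (here refl) =
    cong (suc ∘ length) (sym (trans (filter-reject (λ w → ¬? (y ≟ w)) (λ y≢y → y≢y refl))
                                    (filter-all (λ w → ¬? (y ≟ w)) x∉xs)))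
  length-without {y} {x ∷ xs} (x∉xs ∷ u) (there y∈xs) =
    trans (cong suc (length-without u y∈xs))
          (cong (suc ∘ length) (sym (filter-accept (λ w → ¬? (y ≟ w))
             (λ y≡x → All¬⇒¬Any x∉xs (subst (_∈ xs) y≡x y∈xs)))))

  f-injective : Injective _≡_ _≡_ f
  f-injective = involutive⇒injective f f-involutive

  Closed : List A → Set a
  Closed xs = ∀ {y} → y ∈ xs → f y ∈ xs

  FixedPointFree : List A → Set a
  FixedPointFree xs = ∀ {y} → y ∈ xs → f y ≢ y

  even-length : ∀ {xs} → Unique xs → Closed xs → FixedPointFree xs → 2 ∣ length xs
  even-length {xs} = bounded (length xs) ≤-refl
    where
    bounded : ∀ n {xs} → length xs ≤ n → Unique xs → Closed xs → FixedPointFree xs → 2 ∣ length xs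
    bounded _       {[]}     _         _            _      _   = 2 ∣0
    bounded (suc n) {x ∷ xs} (s≤s len) (x∉xs ∷ uxs) closed fpf =
      subst (λ m → 2 ∣ suc m) (sym (length-without uxs fx∈xs)) (∣m∣n⇒∣m+n ∣-refl ih)
      where
      fx∈xs : f x ∈ xs
      fx∈xs with closed (here refl)
      ... | here fx≡x  = contradiction fx≡x (fpf (here refl))
      ... | there fx∈xs = fx∈xs
      rest = xs without f x
      closed-rest : Closed rest
      closed-rest {y} y∈rest with ∈-without⁻ xs y∈rest
      ... | y∈xs , fx≢y with closed (there y∈xs)
      ...   | here fy≡x   = contradiction (trans (cong f (sym fy≡x)) (f-involutive y)) fx≢y
      ...   | there fy∈xs = ∈-without⁺ fy∈xs λ fx≡fy →
                All¬⇒¬Any x∉xs (subst (_∈ xs) (sym (f-injective fx≡fy)) y∈xs)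
      ih : 2 ∣ length rest
      ih = bounded n (≤-trans (n≤1+n _) (subst (_≤ n) (length-without uxs fx∈xs) len))
             (Unique.filter⁺ _ uxs) closed-rest (fpf ∘ there ∘ proj₁ ∘ ∈-without⁻ xs)

  odd-length : ∀ {z xs} → f z ≡ z → (∀ {y} → f y ≡ y → y ≡ z) →
               Unique xs → Closed xs → z ∈ xs → 2 ∣ suc (length xs)
  odd-length {z} {xs} fz≡z fixed⇒z uxs closed z∈xs =
    subst (λ m → 2 ∣ suc m) (sym (length-without uxs z∈xs))
      (∣m∣n⇒∣m+n ∣-refl (even-length (Unique.filter⁺ _ uxs) closed-rest fpf-rest))
    where
    rest = xs without z
    closed-rest : Closed rest
    closed-rest {y} y∈rest with ∈-without⁻ xs y∈rest
    ... | y∈xs , z≢y = ∈-without⁺ (closed y∈xs) λ z≡fy →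
            z≢y (sym (trans (sym (f-involutive y)) (trans (cong f (sym z≡fy)) fz≡z)))
    fpf-rest : FixedPointFree rest
    fpf-rest y∈rest fy≡y = proj₂ (∈-without⁻ xs y∈rest) (sym (fixed⇒z fy≡y))

module FieldLemmas (F : Field) where
  open Field F
  open FieldOps F using (R)

  ring : CommutativeRing 0ℓ 0ℓ
  ring = record { isCommutativeRing = isCommutativeRing }

  open CommutativeRing ring public
    using (+-identityˡ; +-identityʳ; +-comm; +-assoc; *-identityˡ; *-identityʳ; *-assoc;
           zeroˡ; zeroʳ; distribʳ; -‿inverseˡ; -‿inverseʳ)
  open CommutativeSemigroupProperties (CommutativeRing.*-commutativeSemigroup ring)
    using (xy∙z≈y∙xz; xy∙z≈xz∙y; x∙yz≈y∙xz)
  open ≡-Reasoning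

  x*y≡0⇒y≡0 : ∀ {x y} → x ≢ 0# → x * y ≡ 0# → y ≡ 0#
  x*y≡0⇒y≡0 {x} {y} x≢0 xy≡0 = begin
    y                ≡⟨ sym (*-identityˡ y) ⟩
    1# * y           ≡⟨ cong (_* y) (sym (⁻¹-inverse x x≢0)) ⟩
    (x * x ⁻¹) * y   ≡⟨ xy∙z≈y∙xz x (x ⁻¹) y ⟩
    x ⁻¹ * (x * y)   ≡⟨ cong (x ⁻¹ *_) xy≡0 ⟩
    x ⁻¹ * 0#        ≡⟨ zeroʳ (x ⁻¹) ⟩
    0#               ∎

  *-≢0 : ∀ {x y} → x ≢ 0# → y ≢ 0# → x * y ≢ 0#
  *-≢0 x≢0 y≢0 xy≡0 = y≢0 (x*y≡0⇒y≡0 x≢0 xy≡0)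

  ⁻¹-≢0 : ∀ {x} → x ≢ 0# → x ⁻¹ ≢ 0#
  ⁻¹-≢0 {x} x≢0 x⁻¹≡0 = 0≢1 (begin
    0#          ≡⟨ sym (zeroʳ x) ⟩
    x * 0#      ≡⟨ cong (x *_) (sym x⁻¹≡0) ⟩
    x * x ⁻¹    ≡⟨ ⁻¹-inverse x x≢0 ⟩
    1#          ∎)

  *⁻¹-unique : ∀ {d p r} → d ≢ 0# → p ≡ r * d → p * d ⁻¹ ≡ r
  *⁻¹-unique {d} {p} {r} d≢0 p≡rd = begin
    p * d ⁻¹         ≡⟨ cong (_* d ⁻¹) p≡rd ⟩
    (r * d) * d ⁻¹   ≡⟨ *-assoc r d (d ⁻¹) ⟩
    r * (d * d ⁻¹)   ≡⟨ cong (r *_) (⁻¹-inverse d d≢0) ⟩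
    r * 1#           ≡⟨ *-identityʳ r ⟩
    r                ∎

  *⁻¹-cross : ∀ {d s p r} → d ≢ 0# → s ≢ 0# → p * s ≡ r * d → p * d ⁻¹ ≡ r * s ⁻¹
  *⁻¹-cross {d} {s} {p} {r} d≢0 s≢0 ps≡rd = *⁻¹-unique d≢0 (begin
    p                    ≡⟨ sym (*⁻¹-unique s≢0 refl) ⟩
    (p * s) * s ⁻¹       ≡⟨ cong (_* s ⁻¹) ps≡rd ⟩
    (r * d) * s ⁻¹       ≡⟨ xy∙z≈xz∙y r d (s ⁻¹) ⟩
    (r * s ⁻¹) * d       ∎)

  *⁻¹-involutive : ∀ {a w} → a ≢ 0# → w ≢ 0# → a * (a * w ⁻¹) ⁻¹ ≡ w
  *⁻¹-involutive {a} {w} a≢0 w≢0 = *⁻¹-unique (*-≢0 a≢0 (⁻¹-≢0 w≢0)) (begin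
    a                    ≡⟨ sym (*-identityʳ a) ⟩
    a * 1#               ≡⟨ cong (a *_) (sym (⁻¹-inverse w w≢0)) ⟩
    a * (w * w ⁻¹)       ≡⟨ x∙yz≈y∙xz a w (w ⁻¹) ⟩
    w * (a * w ⁻¹)       ∎)

  +-*⁻¹-self : ∀ {s} p → s ≢ 0# → (p + s) * s ⁻¹ ≡ p * s ⁻¹ + 1#
  +-*⁻¹-self {s} p s≢0 = trans (distribʳ (s ⁻¹) p s) (cong (p * s ⁻¹ +_) (⁻¹-inverse s s≢0))

  -x≡x⇒x≡0 : 1# + 1# ≢ 0# → ∀ {x} → - x ≡ x → x ≡ 0#
  -x≡x⇒x≡0 2≢0 {x} -x≡x = x*y≡0⇒y≡0 2≢0 (begin
    (1# + 1#) * x        ≡⟨ distribʳ x 1# 1# ⟩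
    1# * x + 1# * x      ≡⟨ cong₂ _+_ (trans (*-identityˡ x) (sym -x≡x)) (*-identityˡ x) ⟩
    - x + x              ≡⟨ -‿inverseˡ x ⟩
    0#                   ∎)

  R-0-just : ∀ a y → R a (just 0#) (just y) ≡ a * y ⁻¹
  R-0-just a y = cong₂ (λ n d → n * d ⁻¹)
    (trans (cong (λ t → t + 0# + a) (zeroˡ y)) (trans (cong (_+ a) (+-identityˡ 0#)) (+-identityˡ a)))
    (+-identityˡ y)

  R-just-0 : ∀ a {x} → x ≢ 0# → R a (just x) (just 0#) ≡ a * x ⁻¹ + 1#
  R-just-0 a {x} x≢0 = begin
    (x * 0# + x + a) * (x + 0#) ⁻¹   ≡⟨ cong₂ (λ n d → n * d ⁻¹) numerator (+-identityʳ x) ⟩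
    (a + x) * x ⁻¹                   ≡⟨ +-*⁻¹-self a x≢0 ⟩
    a * x ⁻¹ + 1#                    ∎
    where
    numerator : x * 0# + x + a ≡ a + x
    numerator = trans (cong (λ t → t + x + a) (zeroʳ x))
                      (trans (cong (_+ a) (+-identityˡ x)) (+-comm x a))

even⇒¬odd : ∀ {n} → 2 ∣ n → ¬ 2 ∣ suc n
even⇒¬odd {n} 2∣n 2∣1+n =
  case ∣1⇒≡1 (∣m+n∣m⇒∣n (subst (2 ∣_) (ℕₚ.+-comm 1 n) 2∣1+n) 2∣n) of λ ()

module _ (F : Field) where
  open Field F
  open FieldLemmas F using (ring; -x≡x⇒x≡0)
  open GroupProperties (CommutativeRing.+-group ring) using (⁻¹-involutive; ε⁻¹≈ε)

  -- Negation is an involution of F; unless 1 + 1 = 0 its only fixed point is 0,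
  -- which would make |F| = 2 ^ k odd.
  characteristic-two : ∀ k → 1 ≤ k → Carrier ↔ Fin (2 ^ k) → 1# + 1# ≡ 0#
  characteristic-two k@(suc j) _ e with FiniteFieldOps._≟F_ F k e (1# + 1#) 0#
  ... | yes 2≡0 = 2≡0
  ... | no 2≢0 = contradiction (subst (λ n → 2 ∣ suc n) (length-tabulate from) 2∣1+|F|)
                               (even⇒¬odd (m∣m*n (2 ^ j)))
    where
    open Inverse e using (to; from; strictlyInverseˡ; strictlyInverseʳ)
    open FiniteFieldOps F k e using (_≟F_)
    open InvolutionParity _≟F_ -_ ⁻¹-involutive using (odd-length)

    elements : List Carrier
    elements = tabulate from

    ∈-elements : ∀ x → x ∈ elements
    ∈-elements x = subst (_∈ elements) (strictlyInverseʳ x) (∈-tabulate⁺ (to x))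

    from-injective : ∀ {i j} → from i ≡ from j → i ≡ j
    from-injective {i} {j} p = trans (sym (strictlyInverseˡ i)) (trans (cong to p) (strictlyInverseˡ j))

    2∣1+|F| : 2 ∣ suc (length elements)
    2∣1+|F| = odd-length ε⁻¹≈ε (-x≡x⇒x≡0 2≢0) (Unique.tabulate⁺ from-injective)
                (λ _ → ∈-elements _) (∈-elements 0#)

module CharacteristicTwo (F : Field) (1+1≡0 : Field._+_ F (Field.1# F) (Field.1# F) ≡ Field.0# F) where
  open Field F
  open FieldOps F using (pow; tr)
  open FieldLemmas F
  open ≡-Reasoning

  -- Polynomial identities over F are decided with coefficients in 𝔽₂ = Bool.
  private
    𝔽₂ : RawRing 0ℓ 0ℓ
    𝔽₂ = record { Carrier = Bool ; _≈_ = _≡_ ; _+_ = _xor_ ; _*_ = _∧_ ; -_ = λ b → b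
                ; 0# = false ; 1# = true }

    ⟦_⟧ : Bool → Carrier
    ⟦ b ⟧ = if b then 1# else 0#

    -1≡1 : - 1# ≡ 1#
    -1≡1 = begin
      - 1#                   ≡⟨ sym (+-identityˡ (- 1#)) ⟩
      0# + - 1#              ≡⟨ cong (_+ - 1#) (sym 1+1≡0) ⟩
      1# + 1# + - 1#         ≡⟨ +-assoc 1# 1# (- 1#) ⟩
      1# + (1# + - 1#)       ≡⟨ cong (1# +_) (-‿inverseʳ 1#) ⟩
      1# + 0#                ≡⟨ +-identityʳ 1# ⟩
      1#                     ∎

    𝔽₂⟶F : 𝔽₂ -Raw-AlmostCommutative⟶ fromCommutativeRing ring
    𝔽₂⟶F = record
      { ⟦_⟧    = ⟦_⟧
      ; +-homo = λ { false false → sym (+-identityˡ 0#) ; false true → sym (+-identityˡ 1#)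
                   ; true false → sym (+-identityʳ 1#) ; true true → sym 1+1≡0 }
      ; *-homo = λ { false b → sym (zeroˡ ⟦ b ⟧) ; true b → sym (*-identityˡ ⟦ b ⟧) }
      ; -‿homo = λ { false → sym ε⁻¹≈ε ; true → sym -1≡1 }
      ; 0-homo = refl
      ; 1-homo = refl
      }
      where open GroupProperties (CommutativeRing.+-group ring) using (ε⁻¹≈ε)

    ⟦⟧-injective? : ∀ b c → Maybe (⟦ b ⟧ ≡ ⟦ c ⟧)
    ⟦⟧-injective? false false = just refl
    ⟦⟧-injective? true  true  = just refl
    ⟦⟧-injective? _     _     = nothing

  open RingSolver 𝔽₂ (fromCommutativeRing ring) 𝔽₂⟶F ⟦⟧-injective? public
    using (solve; _:=_; _:+_; _:*_; con)

  x+y≡0⇒x≡y : ∀ {x y} → x + y ≡ 0# → x ≡ y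
  x+y≡0⇒x≡y {x} {y} x+y≡0 = begin
    x              ≡⟨ solve 2 (λ x y → x := y :+ (x :+ y)) refl x y ⟩
    y + (x + y)    ≡⟨ cong (y +_) x+y≡0 ⟩
    y + 0#         ≡⟨ +-identityʳ y ⟩
    y              ∎

  x≢y⇒x+y≢0 : ∀ {x y} → x ≢ y → x + y ≢ 0#
  x≢y⇒x+y≢0 x≢y = x≢y ∘ x+y≡0⇒x≡y

  pow-+ : ∀ x m n → pow x (m ℕ.+ n) ≡ pow x m * pow x n
  pow-+ x zero    n = sym (*-identityˡ (pow x n))
  pow-+ x (suc m) n = trans (cong (x *_) (pow-+ x m n)) (sym (*-assoc x (pow x m) (pow x n)))

  pow-2^suc : ∀ x i → pow x (2 ^ suc i) ≡ pow x (2 ^ i) * pow x (2 ^ i)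
  pow-2^suc x i = trans (cong (λ n → pow x (2 ^ i ℕ.+ n)) (ℕₚ.+-identityʳ (2 ^ i)))
                        (pow-+ x (2 ^ i) (2 ^ i))

  pow-1# : ∀ n → pow 1# n ≡ 1#
  pow-1# zero    = refl
  pow-1# (suc n) = trans (cong (1# *_) (pow-1# n)) (*-identityˡ 1#)

  frobenius : ∀ i x y → pow (x + y) (2 ^ i) ≡ pow x (2 ^ i) + pow y (2 ^ i)
  frobenius zero    x y =
    solve 2 (λ x y → (x :+ y) :* con true := x :* con true :+ y :* con true) refl x y
  frobenius (suc i) x y = begin
    pow (x + y) (2 ^ suc i)                    ≡⟨ pow-2^suc (x + y) i ⟩
    pow (x + y) (2 ^ i) * pow (x + y) (2 ^ i)  ≡⟨ cong₂ _*_ (frobenius i x y) (frobenius i x y) ⟩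
    (X + Y) * (X + Y)
      ≡⟨ solve 2 (λ X Y → (X :+ Y) :* (X :+ Y) := X :* X :+ Y :* Y) refl X Y ⟩
    X * X + Y * Y                              ≡⟨ sym (cong₂ _+_ (pow-2^suc x i) (pow-2^suc y i)) ⟩
    pow x (2 ^ suc i) + pow y (2 ^ suc i)      ∎
    where X = pow x (2 ^ i) ; Y = pow y (2 ^ i)

  tr-+ : ∀ i x y → tr i (x + y) ≡ tr i x + tr i y
  tr-+ zero    x y = sym (+-identityˡ 0#)
  tr-+ (suc i) x y = begin
    tr i (x + y) + pow (x + y) (2 ^ i)                 ≡⟨ cong₂ _+_ (tr-+ i x y) (frobenius i x y) ⟩
    (tr i x + tr i y) + (pow x (2 ^ i) + pow y (2 ^ i))
      ≡⟨ solve 4 (λ a b c d → (a :+ b) :+ (c :+ d) := (a :+ c) :+ (b :+ d))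
                 refl (tr i x) (tr i y) (pow x (2 ^ i)) (pow y (2 ^ i)) ⟩
    (tr i x + pow x (2 ^ i)) + (tr i y + pow y (2 ^ i)) ∎

  tr-0# : ∀ i → tr i 0# ≡ 0#
  tr-0# i = begin
    tr i 0#              ≡⟨ cong (tr i) (sym (+-identityˡ 0#)) ⟩
    tr i (0# + 0#)       ≡⟨ tr-+ i 0# 0# ⟩
    tr i 0# + tr i 0#    ≡⟨ solve 1 (λ t → t :+ t := con false) refl (tr i 0#) ⟩
    0#                   ∎

  tr-1# : ∀ {k} → 2 ∣ k → tr k 1# ≡ 0#
  tr-1# (divides q refl) = tr-1#-even q
    where
    tr-1#-even : ∀ q → tr (q ℕ.* 2) 1# ≡ 0#
    tr-1#-even zero    = refl
    tr-1#-even (suc q) = begin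
      tr (q ℕ.* 2) 1# + pow 1# (2 ^ (q ℕ.* 2)) + pow 1# (2 ^ suc (q ℕ.* 2))
        ≡⟨ cong₂ _+_ (cong₂ _+_ (tr-1#-even q) (pow-1# (2 ^ (q ℕ.* 2))))
                     (pow-1# (2 ^ suc (q ℕ.* 2))) ⟩
      0# + 1# + 1#
        ≡⟨ solve 0 (con false :+ con true :+ con true := con false) refl ⟩
      0# ∎

  tr-+1# : ∀ {k} → 2 ∣ k → ∀ r → tr k (r + 1#) ≡ tr k r
  tr-+1# {k} 2∣k r = begin
    tr k (r + 1#)        ≡⟨ tr-+ k r 1# ⟩
    tr k r + tr k 1#     ≡⟨ cong (tr k r +_) (tr-1# 2∣k) ⟩
    tr k r + 0#          ≡⟨ +-identityʳ (tr k r) ⟩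
    tr k r               ∎

module _ (F : Field) where
  open Field F
  open FieldOps F

  inverse-pair⇒automorphism : ∀ {k a} (σ τ : V → V) →
    (∀ w → σ (τ w) ≡ w) → (∀ x → τ (σ x) ≡ x) →
    (∀ {x y} → x ≢ y → tr k (R a (σ x) (σ y)) ≡ tr k (R a x y)) → IsAutomorphism k a σ
  inverse-pair⇒automorphism {k} {a} σ τ σ∘τ≗id τ∘σ≗id tr-R-σ = bijective , preserves
    where
    bijective : Bijective _≡_ _≡_ σ
    bijective = Bijection.bijective (Inverse⇒Bijection (mk↔ₛ′ σ τ σ∘τ≗id τ∘σ≗id))

    preserves : ∀ x y → Adj k a x y ⇔ Adj k a (σ x) (σ y)
    preserves x y = mk⇔
      (λ (x≢y , t) → x≢y ∘ proj₁ bijective , trans (tr-R-σ x≢y) t)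
      (λ (σx≢σy , t) → σx≢σy ∘ cong σ , trans (sym (tr-R-σ (σx≢σy ∘ cong σ))) t)

module Automorphisms (F : Field) (k : ℕ) (e : Field.Carrier F ↔ Fin (2 ^ k))
  (1+1≡0 : Field._+_ F (Field.1# F) (Field.1# F) ≡ Field.0# F)
  (a : Field.Carrier F) (a≢0 : a ≢ Field.0# F) where
  open Field F
  open FiniteFieldOps F k e
  open FieldLemmas F
  open CharacteristicTwo F 1+1≡0
  open ≡-Reasoning

  σ₂-involutive : ∀ x → σ₂ (σ₂ x) ≡ x
  σ₂-involutive nothing  = refl
  σ₂-involutive (just z) = cong just (solve 1 (λ z → z :+ con true :+ con true := z) refl z)

  R-σ₂ : ∀ {x y} → x ≢ y → R a (σ₂ x) (σ₂ y) ≡ R a x y + 1#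
  R-σ₂ {nothing} {nothing} x≢y = contradiction refl x≢y
  R-σ₂ {nothing} {just y}  _   = refl
  R-σ₂ {just x}  {nothing} _   = refl
  R-σ₂ {just x}  {just y}  x≢y = begin
    ((x + 1#) * (y + 1#) + (x + 1#) + a) * ((x + 1#) + (y + 1#)) ⁻¹
      ≡⟨ cong₂ (λ n d → n * d ⁻¹)
           (solve 3 (λ x y a → (x :+ con true) :* (y :+ con true) :+ (x :+ con true) :+ a
                               := (x :* y :+ x :+ a) :+ (x :+ y)) refl x y a)
           (solve 2 (λ x y → (x :+ con true) :+ (y :+ con true) := x :+ y) refl x y) ⟩
    ((x * y + x + a) + (x + y)) * (x + y) ⁻¹
      ≡⟨ +-*⁻¹-self (x * y + x + a) (x≢y⇒x+y≢0 (x≢y ∘ cong just)) ⟩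
    (x * y + x + a) * (x + y) ⁻¹ + 1# ∎

  ρ : V → V
  ρ nothing  = just 0#
  ρ (just w) with w ≟F 0#
  ... | yes _ = nothing
  ... | no  _ = just (a * w ⁻¹)

  data ρ-Graph : V → V → Set where
    ∞↦0   : ρ-Graph nothing (just 0#)
    0↦∞   : ρ-Graph (just 0#) nothing
    w↦a/w : ∀ {w} → w ≢ 0# → ρ-Graph (just w) (just (a * w ⁻¹))

  ρ-graph : ∀ x → ρ-Graph x (ρ x)
  ρ-graph nothing  = ∞↦0
  ρ-graph (just w) with w ≟F 0#
  ... | yes refl = 0↦∞
  ... | no  w≢0  = w↦a/w w≢0

  ρ-Graph-functional : ∀ {x y z} → ρ-Graph x y → ρ-Graph x z → y ≡ z
  ρ-Graph-functional ∞↦0       ∞↦0       = refl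
  ρ-Graph-functional 0↦∞       0↦∞       = refl
  ρ-Graph-functional 0↦∞       (w↦a/w 0≢0) = contradiction refl 0≢0
  ρ-Graph-functional (w↦a/w 0≢0) 0↦∞     = contradiction refl 0≢0
  ρ-Graph-functional (w↦a/w _) (w↦a/w _) = refl

  ρ-0# : ρ (just 0#) ≡ nothing
  ρ-0# = ρ-Graph-functional (ρ-graph (just 0#)) 0↦∞

  ρ-≢0 : ∀ {w} → w ≢ 0# → ρ (just w) ≡ just (a * w ⁻¹)
  ρ-≢0 w≢0 = ρ-Graph-functional (ρ-graph _) (w↦a/w w≢0)

  a/w≢0 : ∀ {w} → w ≢ 0# → a * w ⁻¹ ≢ 0#
  a/w≢0 w≢0 = *-≢0 a≢0 (⁻¹-≢0 w≢0)

  ρ-involutive : ∀ x → ρ (ρ x) ≡ x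
  ρ-involutive x = ρ-inverts (ρ-graph x)
    where
    ρ-inverts : ∀ {x y} → ρ-Graph x y → ρ y ≡ x
    ρ-inverts ∞↦0           = ρ-0#
    ρ-inverts 0↦∞           = refl
    ρ-inverts (w↦a/w w≢0)   = trans (ρ-≢0 (a/w≢0 w≢0)) (cong just (*⁻¹-involutive a≢0 w≢0))

  x*x⁻¹+1≡0 : ∀ {x} → x ≢ 0# → x * x ⁻¹ + 1# ≡ 0#
  x*x⁻¹+1≡0 {x} x≢0 = trans (cong (_+ 1#) (⁻¹-inverse x x≢0)) 1+1≡0

  R-a/x-a/y : ∀ {x y} → x ≢ 0# → y ≢ 0# → x ≢ y → a * x ⁻¹ ≢ a * y ⁻¹ →
              R a (just (a * x ⁻¹)) (just (a * y ⁻¹)) ≡ R a (just x) (just y) + 1#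
  R-a/x-a/y {x} {y} x≢0 y≢0 x≢y u≢v = begin
    (u * v + u + a) * (u + v) ⁻¹
      ≡⟨ *⁻¹-cross (x≢y⇒x+y≢0 u≢v) (x≢y⇒x+y≢0 x≢y) cross-multiplied ⟩
    (x * y + y + a) * (x + y) ⁻¹
      ≡⟨ cong (_* (x + y) ⁻¹)
           (solve 3 (λ x y a → x :* y :+ y :+ a := (x :* y :+ x :+ a) :+ (x :+ y)) refl x y a) ⟩
    ((x * y + x + a) + (x + y)) * (x + y) ⁻¹
      ≡⟨ +-*⁻¹-self (x * y + x + a) (x≢y⇒x+y≢0 x≢y) ⟩
    (x * y + x + a) * (x + y) ⁻¹ + 1# ∎
    where
    u = a * x ⁻¹
    v = a * y ⁻¹
    -- The two sides differ by an explicit combination of x x⁻¹ + 1 and y y⁻¹ + 1.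
    cross-multiplied : (u * v + u + a) * (x + y) ≡ (x * y + y + a) * (u + v)
    cross-multiplied = begin
      (u * v + u + a) * (x + y)
        ≡⟨ solve 5 (λ a x y i j →
             (a :* i :* (a :* j) :+ a :* i :+ a) :* (x :+ y)
             := (x :* y :+ y :+ a) :* (a :* i :+ a :* j)
                :+ (a :* a :* j :+ a :+ a :* y) :* (x :* i :+ con true)
                :+ (a :* a :* i :+ a :+ a :* x) :* (y :* j :+ con true))
             refl a x y (x ⁻¹) (y ⁻¹) ⟩
      (x * y + y + a) * (u + v) + Cₓ * (x * x ⁻¹ + 1#) + Cᵧ * (y * y ⁻¹ + 1#)
        ≡⟨ cong₂ (λ s t → (x * y + y + a) * (u + v) + Cₓ * s + Cᵧ * t)
                 (x*x⁻¹+1≡0 x≢0) (x*x⁻¹+1≡0 y≢0) ⟩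
      (x * y + y + a) * (u + v) + Cₓ * 0# + Cᵧ * 0#
        ≡⟨ solve 3 (λ p c d → p :+ c :* con false :+ d :* con false := p) refl _ Cₓ Cᵧ ⟩
      (x * y + y + a) * (u + v) ∎
      where
      Cₓ = a * a * y ⁻¹ + a + a * y
      Cᵧ = a * a * x ⁻¹ + a + a * x

  R-Graph : ∀ {x x′ y y′} → ρ-Graph x x′ → ρ-Graph y y′ → x ≢ y → x′ ≢ y′ →
            R a x′ y′ ≡ R a x y + 1#
  R-Graph ∞↦0 ∞↦0 x≢y _ = contradiction refl x≢y
  R-Graph ∞↦0 0↦∞ _ _ = solve 0 (con false := con false :+ con true :+ con true) refl
  R-Graph ∞↦0 (w↦a/w w≢0) _ _ =
    trans (R-0-just a _) (trans (*⁻¹-involutive a≢0 w≢0)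
                                (solve 1 (λ w → w := w :+ con true :+ con true) refl _))
  R-Graph 0↦∞ ∞↦0 _ _ = refl
  R-Graph 0↦∞ 0↦∞ x≢y _ = contradiction refl x≢y
  R-Graph 0↦∞ (w↦a/w w≢0) _ _ = sym (cong (_+ 1#) (R-0-just a _))
  R-Graph (w↦a/w w≢0) ∞↦0 _ _ =
    trans (R-just-0 a (a/w≢0 w≢0)) (cong (_+ 1#) (*⁻¹-involutive a≢0 w≢0))
  R-Graph (w↦a/w w≢0) 0↦∞ _ _ =
    trans (solve 1 (λ t → t := t :+ con true :+ con true) refl _) (sym (cong (_+ 1#) (R-just-0 a w≢0)))
  R-Graph (w↦a/w x≢0) (w↦a/w y≢0) x≢y u≢v =
    R-a/x-a/y x≢0 y≢0 (x≢y ∘ cong just) (u≢v ∘ cong just)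

  R-ρ : ∀ {x y} → x ≢ y → R a (ρ x) (ρ y) ≡ R a x y + 1#
  R-ρ {x} {y} x≢y =
    R-Graph (ρ-graph x) (ρ-graph y) x≢y (x≢y ∘ involutive⇒injective ρ ρ-involutive)

  σ₁≗ρ∘σ₂ : ∀ x → σ₁ a x ≡ ρ (σ₂ x)
  σ₁≗ρ∘σ₂ nothing  = refl
  σ₁≗ρ∘σ₂ (just z) with z ≟F 1#
  ... | yes refl = sym (trans (cong (ρ ∘ just) 1+1≡0) ρ-0#)
  ... | no  z≢1  = sym (ρ-≢0 (x≢y⇒x+y≢0 z≢1))

  R-σ₁ : ∀ {x y} → x ≢ y → R a (σ₁ a x) (σ₁ a y) ≡ R a x y
  R-σ₁ {x} {y} x≢y = begin
    R a (σ₁ a x) (σ₁ a y)        ≡⟨ cong₂ (R a) (σ₁≗ρ∘σ₂ x) (σ₁≗ρ∘σ₂ y) ⟩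
    R a (ρ (σ₂ x)) (ρ (σ₂ y))    ≡⟨ R-ρ (x≢y ∘ involutive⇒injective σ₂ σ₂-involutive) ⟩
    R a (σ₂ x) (σ₂ y) + 1#       ≡⟨ cong (_+ 1#) (R-σ₂ x≢y) ⟩
    R a x y + 1# + 1#            ≡⟨ solve 1 (λ r → r :+ con true :+ con true := r) refl (R a x y) ⟩
    R a x y                      ∎

  σ₁-automorphism : IsAutomorphism k a (σ₁ a)
  σ₁-automorphism = inverse-pair⇒automorphism F {k} {a} (σ₁ a) (σ₂ ∘ ρ)
                      σ₁∘σ₂∘ρ≗id σ₂∘ρ∘σ₁≗id (cong (tr k) ∘ R-σ₁)
    where
    σ₁∘σ₂∘ρ≗id : ∀ w → σ₁ a (σ₂ (ρ w)) ≡ w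
    σ₁∘σ₂∘ρ≗id w = begin
      σ₁ a (σ₂ (ρ w))      ≡⟨ σ₁≗ρ∘σ₂ (σ₂ (ρ w)) ⟩
      ρ (σ₂ (σ₂ (ρ w)))    ≡⟨ cong ρ (σ₂-involutive (ρ w)) ⟩
      ρ (ρ w)              ≡⟨ ρ-involutive w ⟩
      w                    ∎
    σ₂∘ρ∘σ₁≗id : ∀ x → σ₂ (ρ (σ₁ a x)) ≡ x
    σ₂∘ρ∘σ₁≗id x = begin
      σ₂ (ρ (σ₁ a x))      ≡⟨ cong (σ₂ ∘ ρ) (σ₁≗ρ∘σ₂ x) ⟩
      σ₂ (ρ (ρ (σ₂ x)))    ≡⟨ cong σ₂ (ρ-involutive (σ₂ x)) ⟩
      σ₂ (σ₂ x)            ≡⟨ σ₂-involutive x ⟩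
      x                    ∎

  σ₂-automorphism : 2 ∣ k → IsAutomorphism k a σ₂
  σ₂-automorphism 2∣k = inverse-pair⇒automorphism F {k} {a} σ₂ σ₂ σ₂-involutive σ₂-involutive
    λ x≢y → trans (cong (tr k) (R-σ₂ x≢y)) (tr-+1# 2∣k _)

mainTheorem2 : (k : ℕ) → 1 ≤ k → (F : Field) → (e : Field.Carrier F ↔ Fin (2 ^ k))
    → (a : Field.Carrier F) → FiniteFieldOps.tr F k e k a ≡ Field.1# F
    → FiniteFieldOps.IsAutomorphism F k e k a (FiniteFieldOps.σ₁ F k e a)
      × (2 ∣ k → FiniteFieldOps.IsAutomorphism F k e k a (FiniteFieldOps.σ₂ F k e))
mainTheorem2 k k≥1 F e a tr-a≡1 = σ₁-automorphism , σ₂-automorphism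
  where
  open Field F using (0≢1)
  1+1≡0 = characteristic-two F k k≥1 e
  open CharacteristicTwo F 1+1≡0 using (tr-0#)

  a≢0 : a ≢ Field.0# F
  a≢0 refl = 0≢1 (trans (sym (tr-0# k)) tr-a≡1)

  open Automorphisms F k e 1+1≡0 a a≢0 using (σ₁-automorphism; σ₂-automorphism)
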